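{- For every finite $n\geq 2$, the class $RTA_n$ is not a variety.
   Context: For a set $U$ and finite $n$, the full transposition set algebra is $\wp({}^nU)=\langle\mathcal P({}^nU),\cap,-,S_{ij}\rangle_{i\neq j<n}$, where $S_{ij}(X)=\{q\in{}^nU:q\circ[i,j]\in X\}$ and $[i,j]$ is the transposition swapping $i$ and $j$. $RTA_n=\mathbf{SP}\{\wp({}^nU):U\text{ a set}\}$ (closure under isomorphic copies of subalgebras and direct products). A variety is a class closed under homomorphic images, subalgebras and direct products. -}

module Defs where

open import Data.Nat using (ℕ)
open import Data.Fin using (Fin)
open import Data.Fin.Permutation.Components using (transpose)
open import Data.Vec using (Vec; tabulate; lookup)
open import Data.Bool using (Bool; not; _∧_)
open import Data.Product using (Σ; ∃; _×_; _,_)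
open import Relation.Binary.PropositionalEquality using (_≡_; _≢_)
open import Relation.Binary.Structures using (IsEquivalence)
open import Relation.Nullary using (¬_)

record TAlg (n : ℕ) : Set₁ where
  field
    Carrier : Set
    _≈_     : Carrier → Carrier → Set
    isEquivalence : IsEquivalence _≈_
    _∩_     : Carrier → Carrier → Carrier
    ─_      : Carrier → Carrier
    S       : (i j : Fin n) → i ≢ j → Carrier → Carrier
    ∩-cong  : ∀ {x x' y y'} → x ≈ x' → y ≈ y' → (x ∩ y) ≈ (x' ∩ y')
    ─-cong  : ∀ {x x'} → x ≈ x' → (─ x) ≈ (─ x')
    S-cong  : ∀ i j (p : i ≢ j) {x x'} → x ≈ x' → S i j p x ≈ S i j p x'

open TAlg

record Hom {n : ℕ} (A B : TAlg n) : Set where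
  field
    f      : Carrier A → Carrier B
    f-cong : ∀ {x y} → _≈_ A x y → _≈_ B (f x) (f y)
    f-∩    : ∀ x y → _≈_ B (f (_∩_ A x y)) (_∩_ B (f x) (f y))
    f-─    : ∀ x → _≈_ B (f (─_ A x)) (─_ B (f x))
    f-S    : ∀ i j (p : i ≢ j) x → _≈_ B (f (S A i j p x)) (S B i j p (f x))

open Hom

Injective : {n : ℕ} {A B : TAlg n} → Hom A B → Set
Injective {A = A} {B} h = ∀ x y → _≈_ B (f h x) (f h y) → _≈_ A x y

Surjective : {n : ℕ} {A B : TAlg n} → Hom A B → Set
Surjective {A = A} {B} h = ∀ b → Σ (Carrier A) λ a → _≈_ B (f h a) b

Π-alg : {n : ℕ} (I : Set) → (I → TAlg n) → TAlg n
Π-alg I A = record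
  { Carrier = (k : I) → Carrier (A k)
  ; _≈_ = λ x y → ∀ k → _≈_ (A k) (x k) (y k)
  ; isEquivalence = record
      { refl  = λ {x} k → IsEquivalence.refl (isEquivalence (A k))
      ; sym   = λ e k → IsEquivalence.sym (isEquivalence (A k)) (e k)
      ; trans = λ e e' k → IsEquivalence.trans (isEquivalence (A k)) (e k) (e' k) }
  ; _∩_ = λ x y k → _∩_ (A k) (x k) (y k)
  ; ─_ = λ x k → ─_ (A k) (x k)
  ; S = λ i j p x k → S (A k) i j p (x k)
  ; ∩-cong = λ e e' k → ∩-cong (A k) (e k) (e' k)
  ; ─-cong = λ e k → ─-cong (A k) (e k)
  ; S-cong = λ i j p e k → S-cong (A k) i j p (e k) }

_∘[_,_] : {n : ℕ} {U : Set} → Vec U n → Fin n → Fin n → Vec U n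
q ∘[ i , j ] = tabulate (λ k → lookup q (transpose i j k))

-- The full transposition set algebra ℘(ⁿU). Subsets of ⁿU are
-- represented by their characteristic functions ⁿU → Bool, compared
-- extensionally (pointwise).
℘ : (n : ℕ) → Set → TAlg n
℘ n U = record
  { Carrier = Vec U n → Bool
  ; _≈_ = λ X Y → ∀ q → X q ≡ Y q
  ; isEquivalence = record
      { refl = λ q → Relation.Binary.PropositionalEquality.refl
      ; sym = λ e q → Relation.Binary.PropositionalEquality.sym (e q)
      ; trans = λ e e' q → Relation.Binary.PropositionalEquality.trans (e q) (e' q) }
  ; _∩_ = λ X Y q → X q ∧ Y q
  ; ─_ = λ X q → not (X q)
  ; S = λ i j p X q → X (q ∘[ i , j ])
  ; ∩-cong = λ e e' q → Relation.Binary.PropositionalEquality.cong₂ _∧_ (e q) (e' q)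
  ; ─-cong = λ e q → Relation.Binary.PropositionalEquality.cong not (e q)
  ; S-cong = λ i j p e q → e (q ∘[ i , j ]) }

Class : ℕ → Set₂
Class n = TAlg n → Set₁

-- RTA_n = SP{℘(ⁿU) : U a set}: algebras embeddable (injective
-- homomorphism, i.e. isomorphic to a subalgebra) into a direct product
-- of full transposition set algebras.
RTA : (n : ℕ) → Class n
RTA n A = Σ Set λ I → Σ (I → Set) λ U →
          Σ (Hom A (Π-alg I (λ k → ℘ n (U k)))) λ h → Injective h

ClosedH : {n : ℕ} → Class n → Set₁
ClosedH K = ∀ A B → K A → (h : Hom A B) → Surjective h → K B

ClosedS : {n : ℕ} → Class n → Set₁
ClosedS K = ∀ A B → K B → (h : Hom A B) → Injective h → K A

ClosedP : {n : ℕ} → Class n → Set₁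
ClosedP K = ∀ (I : Set) (A : I → TAlg _) → (∀ k → K (A k)) → K (Π-alg I A)

IsVariety : {n : ℕ} → Class n → Set₁
IsVariety K = ClosedH K × ClosedS K × ClosedP K

module Submission where

-- RTA_n is not a variety because it is not closed under homomorphic images.
--
-- (1) RTA_n satisfies the quasi-equation  S_ij x = -x  ⟹  y = z.  In a full
--     algebra ℘(ⁿV) a constant sequence is fixed by [i,j], so it cannot lie
--     in exactly one of X and S_ij X; hence S_ij X = -X forces ⁿV = ∅, and a
--     product of such algebras is trivial.  The quasi-equation transfers to
--     every algebra embeddable into a product of full algebras.
-- (2) Identifying two subsets of ⁿU when they contain the same repetition-free
--     sequences is a congruence of ℘(ⁿU); the quotient ℘≠(ⁿU) is thus a
--     homomorphic image of a member of RTA_n.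
-- (3) For n ≥ 2 the set "q₀ < q₁" in ℘≠(ⁿℕ) is mapped to its complement by
--     S₀₁, although ℘≠(ⁿℕ) is non-trivial.  By (1) it is not in RTA_n.

open import Defs
open import Data.Nat using (ℕ; _≤_; zero; suc; s≤s; _<ᵇ_)
open import Data.Fin using (Fin; toℕ; zero; suc)
open import Data.Fin.Properties using (toℕ-injective)
open import Data.Fin.Permutation.Components using (transpose; transpose-inverse)
open import Data.Vec using (Vec; tabulate; lookup; replicate)
open import Data.Vec.Properties
  using (lookup∘tabulate; tabulate∘lookup; tabulate-cong; lookup-replicate)
open import Data.Bool using (Bool; not; _∧_)
open import Data.Bool.Properties using (not-¬)
open import Data.Empty using (⊥; ⊥-elim)
open import Data.Unit using (⊤; tt)
open import Data.Product using (_,_)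
open import Function.Definitions using () renaming (Injective to Injectiveᶠ)
open import Relation.Nullary using (¬_)
open import Relation.Binary.PropositionalEquality hiding (isEquivalence)
open import Relation.Binary.Structures using (IsEquivalence)
open TAlg
open Hom

lookup-∘[] : ∀ {n} {U : Set} (q : Vec U n) (i j k : Fin n) →
             lookup (q ∘[ i , j ]) k ≡ lookup q (transpose i j k)
lookup-∘[] q i j = lookup∘tabulate (λ k → lookup q (transpose i j k))

replicate-∘[] : ∀ {n} {U : Set} (a : U) (i j : Fin n) →
                replicate n a ∘[ i , j ] ≡ replicate n a
replicate-∘[] {n} a i j = begin
  tabulate (λ k → lookup (replicate n a) (transpose i j k))
    ≡⟨ tabulate-cong (λ k → trans (lookup-replicate (transpose i j k) a)
                                  (sym (lookup-replicate k a))) ⟩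
  tabulate (lookup (replicate n a))
    ≡⟨ tabulate∘lookup (replicate n a) ⟩
  replicate n a ∎
  where open ≡-Reasoning

-- In ℘(ⁿV), S_ij X = -X is only possible when ⁿV is empty: a constant
-- sequence d would satisfy X d = X (d ∘ [i,j]) = not (X d).
swap-complement⇒empty : ∀ {n} {V : Set} (i j : Fin n) (p : i ≢ j) (X : Vec V n → Bool) →
                        _≈_ (℘ n V) (S (℘ n V) i j p X) (─_ (℘ n V) X) → ¬ Vec V n
swap-complement⇒empty {n} {V} i j p X swapX q =
  not-¬ refl (trans (cong X (sym (replicate-∘[] a i j))) (swapX d))
  where
    a : V
    a = lookup q i
    d : Vec V n
    d = replicate n a

Π℘ : ∀ n (I : Set) → (I → Set) → TAlg n
Π℘ n I U = Π-alg I (λ k → ℘ n (U k))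

-- Hence in such a product S_ij Y = -Y makes all elements equal: every
-- factor has an empty set of sequences.
Π℘-swap-complement⇒trivial : ∀ {n} {I : Set} {U : I → Set} (i j : Fin n) (p : i ≢ j)
  (Y : Carrier (Π℘ n I U)) → _≈_ (Π℘ n I U) (S (Π℘ n I U) i j p Y) (─_ (Π℘ n I U) Y) →
  ∀ Z W → _≈_ (Π℘ n I U) Z W
Π℘-swap-complement⇒trivial i j p Y swapY Z W k q =
  ⊥-elim (swap-complement⇒empty i j p (Y k) (swapY k) q)

-- The quasi-equation  S_ij x = -x ⟹ y = z  holds in every member of RTA_n:
-- push the hypothesis through the embedding and pull the conclusion back.
RTA-swap-complement⇒trivial : ∀ {n} (A : TAlg n) → RTA n A →
  ∀ (i j : Fin n) (p : i ≢ j) x → _≈_ A (S A i j p x) (─_ A x) →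
  ∀ y z → _≈_ A y z
RTA-swap-complement⇒trivial {n} A (I , U , h , h-injective) i j p x swapx y z =
  h-injective y z (Π℘-swap-complement⇒trivial i j p (f h x) swap-hx (f h y) (f h z))
  where
    P : TAlg n
    P = Π℘ n I U
    open IsEquivalence (isEquivalence P) renaming (sym to symP; trans to transP)
    swap-hx : _≈_ P (S P i j p (f h x)) (─_ P (f h x))
    swap-hx = transP (symP (f-S h i j p x)) (transP (f-cong h swapx) (f-─ h x))

℘∈RTA : ∀ n (U : Set) → RTA n (℘ n U)
℘∈RTA n U = ⊤ , (λ _ → U) , embed , (λ X Y e → e tt)
  where
    embed : Hom (℘ n U) (Π℘ n ⊤ (λ _ → U))
    embed = record
      { f = λ X _ → X ; f-cong = λ e _ → e
      ; f-∩ = λ _ _ _ _ → refl ; f-─ = λ _ _ _ → refl ; f-S = λ _ _ _ _ _ _ → refl }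

Distinct : ∀ {n} {U : Set} → Vec U n → Set
Distinct q = Injectiveᶠ _≡_ _≡_ (lookup q)

Distinct-∘[] : ∀ {n} {U : Set} (q : Vec U n) (i j : Fin n) →
               Distinct q → Distinct (q ∘[ i , j ])
Distinct-∘[] q i j distinct {a} {b} e = begin
  a                                    ≡⟨ sym (transpose-inverse j i) ⟩
  transpose j i (transpose i j a)      ≡⟨ cong (transpose j i) (distinct same) ⟩
  transpose j i (transpose i j b)      ≡⟨ transpose-inverse j i ⟩
  b ∎
  where
    open ≡-Reasoning
    same : lookup q (transpose i j a) ≡ lookup q (transpose i j b)
    same = trans (sym (lookup-∘[] q i j a)) (trans e (lookup-∘[] q i j b))

-- ℘≠(ⁿU): the operations of ℘(ⁿU), but two subsets are identified when they
-- contain the same repetition-free sequences.  This is a congruence because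
-- S_ij maps repetition-free sequences to repetition-free sequences.
℘≠ : ∀ n → Set → TAlg n
℘≠ n U = record
  { Carrier = Vec U n → Bool
  ; _≈_ = λ X Y → ∀ q → Distinct q → X q ≡ Y q
  ; isEquivalence = record
      { refl = λ q _ → refl
      ; sym = λ e q dq → sym (e q dq)
      ; trans = λ e e' q dq → trans (e q dq) (e' q dq) }
  ; _∩_ = _∩_ (℘ n U)
  ; ─_ = ─_ (℘ n U)
  ; S = S (℘ n U)
  ; ∩-cong = λ e e' q dq → cong₂ _∧_ (e q dq) (e' q dq)
  ; ─-cong = λ e q dq → cong not (e q dq)
  ; S-cong = λ i j p e q dq → e (q ∘[ i , j ]) (Distinct-∘[] q i j dq) }

quotient : ∀ n (U : Set) → Hom (℘ n U) (℘≠ n U)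
quotient n U = record
  { f = λ X → X ; f-cong = λ e q _ → e q
  ; f-∩ = λ _ _ _ _ → refl ; f-─ = λ _ _ _ → refl ; f-S = λ _ _ _ _ _ _ → refl }

quotient-surjective : ∀ n (U : Set) → Surjective (quotient n U)
quotient-surjective n U X = X , λ _ _ → refl

℘≠-nontrivial : ∀ {n} {U : Set} (q : Vec U n) → Distinct q →
                (X : Vec U n → Bool) → ¬ _≈_ (℘≠ n U) X (─_ (℘≠ n U) X)
℘≠-nontrivial q distinct X X≈─X = not-¬ refl (X≈─X q distinct)

identitySequence : ∀ n → Vec ℕ n
identitySequence n = tabulate toℕ

identitySequence-distinct : ∀ n → Distinct (identitySequence n)
identitySequence-distinct n {a} {b} e =
  toℕ-injective (trans (sym (lookup∘tabulate toℕ a)) (trans e (lookup∘tabulate toℕ b)))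

<ᵇ-flip : ∀ a b → a ≢ b → (b <ᵇ a) ≡ not (a <ᵇ b)
<ᵇ-flip zero    zero    a≢b = ⊥-elim (a≢b refl)
<ᵇ-flip zero    (suc b) _   = refl
<ᵇ-flip (suc a) zero    _   = refl
<ᵇ-flip (suc a) (suc b) a≢b = <ᵇ-flip a b (λ e → a≢b (cong suc e))

-- For n ≥ 2, the set of sequences with q₀ < q₁ is complemented by S₀₁ in
-- ℘≠(ⁿℕ): swapping two different entries reverses their order.
module _ (m : ℕ) where
  private
    n : ℕ
    n = suc (suc m)

  i₀ i₁ : Fin n
  i₀ = zero
  i₁ = suc zero

  i₀≢i₁ : i₀ ≢ i₁
  i₀≢i₁ ()

  ascending : Vec ℕ n → Bool
  ascending q = lookup q i₀ <ᵇ lookup q i₁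

  swap-ascending : _≈_ (℘≠ n ℕ) (S (℘≠ n ℕ) i₀ i₁ i₀≢i₁ ascending)
                                (─_ (℘≠ n ℕ) ascending)
  swap-ascending q distinct = begin
    lookup (q ∘[ i₀ , i₁ ]) i₀ <ᵇ lookup (q ∘[ i₀ , i₁ ]) i₁
      ≡⟨ cong₂ _<ᵇ_ (lookup-∘[] q i₀ i₁ i₀)
                     (lookup-∘[] q i₀ i₁ i₁) ⟩
    lookup q i₁ <ᵇ lookup q i₀
      ≡⟨ <ᵇ-flip (lookup q i₀) (lookup q i₁) (λ e → i₀≢i₁ (distinct e)) ⟩
    not (ascending q) ∎
    where open ≡-Reasoning

  -- ℘≠(ⁿℕ) violates the quasi-equation, so it lies outside RTA_n.
  ℘≠∉RTA : ¬ RTA n (℘≠ n ℕ)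
  ℘≠∉RTA member =
    ℘≠-nontrivial (identitySequence n) (identitySequence-distinct n) ascending
      (RTA-swap-complement⇒trivial (℘≠ n ℕ) member i₀ i₁ i₀≢i₁
         ascending swap-ascending ascending (─_ (℘≠ n ℕ) ascending))

mainTheorem3 : (n : ℕ) → 2 ≤ n → ¬ IsVariety (RTA n)
mainTheorem3 (suc (suc m)) (s≤s (s≤s _)) (closedH , _ , _) =
  ℘≠∉RTA m (closedH (℘ _ ℕ) (℘≠ _ ℕ) (℘∈RTA _ ℕ)
                    (quotient _ ℕ) (quotient-surjective _ ℕ))
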